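{- Let $q\ge8$ be even and $\mu\in\mathbb{F}_q\setminus\{0,1\}$. Let $\ell_\mu$ be the line through $\mathrm{P}(0,\mu,0,1)$ and $R_{\mu,\infty}=\mathrm{P}(1,0,1,0)$, and let $\psi$ be an element of $G_q$ fixing $\ell_\mu$ and fixing the point $R_{\mu,\infty}$. Then $\psi$ is the identity.
   Context: $\mathrm{P}(x_0,x_1,x_2,x_3)$ denotes a point of $\mathrm{PG}(3,q)$ in homogeneous coordinates. The twisted cubic is $\mathcal{C}=\{P(t): t\in\mathbb{F}_q\cup\{\infty\}\}$, $P(t)=\mathrm{P}(t^3,t^2,t,1)$ for $t\in\mathbb{F}_q$, $P(\infty)=\mathrm{P}(1,0,0,0)$. $G_q$ is the group of projectivities of $\mathrm{PG}(3,q)$ mapping $\mathcal{C}$ onto itself; for $q\ge5$ its elements are exactly the maps $\mathrm{P}(x)\mapsto\mathrm{P}(xM)$ ($x$ a row vector) with $M=\begin{pmatrix} a^3&a^2c&ac^2&c^3\\ 3a^2b&a^2d+2abc&bc^2+2acd&3c^2d\\ 3ab^2&b^2c+2abd&ad^2+2bcd&3cd^2\\ b^3&b^2d&bd^2&d^3\end{pmatrix}$, $a,b,c,d\in\mathbb{F}_q$, $ad-bc\ne0$. -}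

module Defs where

open import Level using (0ℓ)
open import Data.Nat using (ℕ; _≤_)
open import Data.Fin using (Fin) renaming (zero to f0; suc to fs)
open import Data.Product using (Σ; _×_; _,_; ∃)
open import Relation.Binary.PropositionalEquality using (_≡_)
open import Relation.Binary.Definitions using (Decidable)
open import Algebra.Bundles using (CommutativeRing)

record FiniteField (q : ℕ) : Set₁ where
  field
    commRing : CommutativeRing 0ℓ 0ℓ
  open CommutativeRing commRing public
  field
    _≟_      : Decidable _≈_
    1≉0      : 1# ≉ 0#
    inverse  : ∀ x → x ≉ 0# → Σ Carrier (λ y → x * y ≈ 1#)
    enum     : Fin q → Carrier
    enum-inj : ∀ i j → enum i ≈ enum j → i ≡ j
    enum-sur : ∀ x → Σ (Fin q) (λ i → enum i ≈ x)

module _ {q : ℕ} (F : FiniteField q) where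
  open FiniteField F

  -- q even  <=>  characteristic 2 (for a finite field of order q)
  Char2 : Set
  Char2 = 1# + 1# ≈ 0#

  2# 3# : Carrier
  2# = 1# + 1#
  3# = 1# + 1# + 1#

  -- homogeneous coordinate vectors of PG(3,q)
  Vec4 : Set
  Vec4 = Fin 4 → Carrier

  vec : Carrier → Carrier → Carrier → Carrier → Vec4
  vec x0 x1 x2 x3 f0 = x0
  vec x0 x1 x2 x3 (fs f0) = x1
  vec x0 x1 x2 x3 (fs (fs f0)) = x2
  vec x0 x1 x2 x3 (fs (fs (fs f0))) = x3

  _≈v_ : Vec4 → Vec4 → Set
  x ≈v y = ∀ i → x i ≈ y i

  NonZeroV : Vec4 → Set
  NonZeroV x = Σ (Fin 4) (λ i → x i ≉ 0#)

  SamePoint : Vec4 → Vec4 → Set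
  SamePoint x y = Σ Carrier (λ λ' → (λ' ≉ 0#) × (∀ i → y i ≈ λ' * x i))

  Mat4 : Set
  Mat4 = Fin 4 → Fin 4 → Carrier

  _·M_ : Vec4 → Mat4 → Vec4
  (x ·M M) j = x f0 * M f0 j + x (fs f0) * M (fs f0) j
             + x (fs (fs f0)) * M (fs (fs f0)) j
             + x (fs (fs (fs f0))) * M (fs (fs (fs f0))) j

  -- the matrix M(a,b,c,d) of the context, representing elements of G_q
  Mψ : Carrier → Carrier → Carrier → Carrier → Mat4
  Mψ a b c d i j = vec (row0 j) (row1 j) (row2 j) (row3 j) i
    where
    row0 row1 row2 row3 : Fin 4 → Carrier
    row0 = vec (a * a * a) (a * a * c) (a * c * c) (c * c * c)
    row1 = vec (3# * (a * a) * b) (a * a * d + 2# * a * b * c)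
               (b * c * c + 2# * a * c * d) (3# * (c * c) * d)
    row2 = vec (3# * a * (b * b)) (b * b * c + 2# * a * b * d)
               (a * d * d + 2# * b * c * d) (3# * c * (d * d))
    row3 = vec (b * b * b) (b * b * d) (b * d * d) (d * d * d)

  ψmap : Carrier → Carrier → Carrier → Carrier → Vec4 → Vec4
  ψmap a b c d x = x ·M Mψ a b c d

  OnLine : Vec4 → Vec4 → Vec4 → Set
  OnLine u v x = Σ Carrier (λ α → Σ Carrier (λ β → ∀ i → x i ≈ α * u i + β * v i))

  FixesLine : (Vec4 → Vec4) → Vec4 → Vec4 → Set
  FixesLine f u v =
    (∀ x → NonZeroV x → OnLine u v x → OnLine u v (f x)) ×
    (∀ y → NonZeroV y → OnLine u v y →
       Σ Vec4 (λ x → NonZeroV x × OnLine u v x × SamePoint (f x) y))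

  FixesPoint : (Vec4 → Vec4) → Vec4 → Set
  FixesPoint f x = SamePoint x (f x)

  IsIdentity : (Vec4 → Vec4) → Set
  IsIdentity f = ∀ x → NonZeroV x → SamePoint x (f x)

  Pμ : Carrier → Vec4
  Pμ μ = vec 0# μ 0# 1#

  R∞ : Vec4
  R∞ = vec 1# 0# 1# 0#

-- In characteristic 2 the matrix M(a,b,c,d) loses all its coefficients 2 and 3,
-- and ψ(R∞) = (a(a+b)², c(a+b)², a(c+d)², c(c+d)²).  Fixing R∞ therefore forces
-- c = 0: otherwise a = b and c = d, and the determinant vanishes.  With c = 0 the
-- image of P(0,μ,0,1) lies on ℓ_μ = {x₀ = x₂, x₁ = μ x₃} exactly when
-- b(μa² + b²) = bd² and d(μa² + b²) = μd³.  As d ≠ 0 the second equation gives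
-- μa² + b² = μd², so b ≠ 0 would force μ = 1.  Hence b = 0 and a² = d², and since
-- squaring is injective in characteristic 2, a = d: M(a,0,0,a) = a³·I.
module Submission where

open import Defs
open import Data.Nat using (ℕ; _≤_)
open import Data.Product using (_×_; _,_; proj₁; proj₂)

open import Data.Empty using (⊥-elim)
open import Data.Fin using (#_) renaming (zero to f0; suc to fs)
open import Relation.Nullary using (yes; no)
import Algebra.Properties.Ring as RingProperties
import Algebra.Solver.Ring.NaturalCoefficients.Default as Solver
import Relation.Binary.Reasoning.Setoid as SetoidReasoning

module FieldProperties {q : ℕ} (F : FiniteField q) where
  open FiniteField F
  open SetoidReasoning setoid

  *-cancelˡ-nonzero : ∀ {x y z} → x ≉ 0# → x * y ≈ x * z → y ≈ z
  *-cancelˡ-nonzero {x} {y} {z} x≉0 xy≈xz with inverse x x≉0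
  ... | x⁻¹ , xx⁻¹≈1 = begin
    y               ≈⟨ x⁻¹[x*w]≈w y ⟨
    x⁻¹ * (x * y)   ≈⟨ *-congˡ xy≈xz ⟩
    x⁻¹ * (x * z)   ≈⟨ x⁻¹[x*w]≈w z ⟩
    z               ∎
    where
    x⁻¹[x*w]≈w : ∀ w → x⁻¹ * (x * w) ≈ w
    x⁻¹[x*w]≈w w = begin
      x⁻¹ * (x * w)  ≈⟨ *-assoc x⁻¹ x w ⟨
      x⁻¹ * x * w    ≈⟨ *-congʳ (trans (*-comm x⁻¹ x) xx⁻¹≈1) ⟩
      1# * w         ≈⟨ *-identityˡ w ⟩
      w              ∎

  *-nonzero : ∀ {x y} → x ≉ 0# → y ≉ 0# → x * y ≉ 0#
  *-nonzero {x} x≉0 y≉0 xy≈0 = y≉0 (*-cancelˡ-nonzero x≉0 (trans xy≈0 (sym (zeroʳ x))))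

  x*x≈0⇒x≈0 : ∀ {x} → x * x ≈ 0# → x ≈ 0#
  x*x≈0⇒x≈0 {x} x*x≈0 with x ≟ 0#
  ... | yes x≈0 = x≈0
  ... | no x≉0 = ⊥-elim (*-nonzero x≉0 x≉0 x*x≈0)

module PointsAndLines {q : ℕ} (F : FiniteField q) where
  open FiniteField F
  open SetoidReasoning setoid

  onLine-left : ∀ u v → OnLine F u v u
  onLine-left u v = 1# , 0# , λ i → sym (trans (+-cong (*-identityˡ (u i)) (zeroˡ (v i)))
                                               (+-identityʳ (u i)))

  samePoint-R∞ : ∀ {y} → SamePoint F (R∞ F) y → y (# 1) ≈ 0# × y (# 3) ≈ 0#
  samePoint-R∞ (λ′ , _ , y≈λ′R∞) = trans (y≈λ′R∞ (# 1)) (zeroʳ λ′) , trans (y≈λ′R∞ (# 3)) (zeroʳ λ′)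

  onLine-Pμ-R∞ : ∀ {μ y} → OnLine F (Pμ F μ) (R∞ F) y → y (# 0) ≈ y (# 2) × y (# 1) ≈ μ * y (# 3)
  onLine-Pμ-R∞ {μ} {y} (α , β , y≈) = trans (y≈ (# 0)) (sym (y≈ (# 2))) , (begin
    y (# 1)          ≈⟨ y≈ (# 1) ⟩
    α * μ + β * 0#   ≈⟨ trans (+-congˡ (zeroʳ β)) (+-identityʳ _) ⟩
    α * μ            ≈⟨ *-comm α μ ⟩
    μ * α            ≈⟨ *-congˡ y₃≈α ⟨
    μ * y (# 3)      ∎)
    where
    y₃≈α : y (# 3) ≈ α
    y₃≈α = trans (y≈ (# 3)) (trans (+-cong (*-identityʳ α) (zeroʳ β)) (+-identityʳ α))

module MatrixProperties {q : ℕ} (F : FiniteField q) where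
  open FiniteField F
  open Solver commutativeSemiring
  open SetoidReasoning setoid

  ·M-congʳ : ∀ {M N} → (∀ i j → M i j ≈ N i j) → ∀ x j → _·M_ F x M j ≈ _·M_ F x N j
  ·M-congʳ M≈N x j = +-cong (+-cong (+-cong (*-congˡ (M≈N _ j)) (*-congˡ (M≈N _ j)))
                                    (*-congˡ (M≈N _ j)))
                            (*-congˡ (M≈N _ j))

  R∞·M : ∀ N j → _·M_ F (R∞ F) N j ≈ N (# 0) j + N (# 2) j
  R∞·M N j = begin
    1# * N (# 0) j + 0# * N (# 1) j + 1# * N (# 2) j + 0# * N (# 3) j
      ≈⟨ +-cong (+-cong (+-cong (*-identityˡ _) (zeroˡ _)) (*-identityˡ _)) (zeroˡ _) ⟩
    N (# 0) j + 0# + N (# 2) j + 0#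
      ≈⟨ trans (+-identityʳ _) (+-congʳ (+-identityʳ _)) ⟩
    N (# 0) j + N (# 2) j ∎

  Pμ·M : ∀ μ N j → _·M_ F (Pμ F μ) N j ≈ μ * N (# 1) j + N (# 3) j
  Pμ·M μ N j = begin
    0# * N (# 0) j + μ * N (# 1) j + 0# * N (# 2) j + 1# * N (# 3) j
      ≈⟨ +-cong (+-cong (+-congʳ (zeroˡ _)) (zeroˡ _)) (*-identityˡ _) ⟩
    0# + μ * N (# 1) j + 0# + N (# 3) j
      ≈⟨ +-congʳ (trans (+-identityʳ _) (+-identityˡ _)) ⟩
    μ * N (# 1) j + N (# 3) j ∎

  -- M(a,b,c,d) with 2 = 0 and 3 = 1; it is the Kronecker product A⁽²⁾ ⊗ A of the
  -- Frobenius twist of A = (a c; b d) with A.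
  Mψ₂ : Carrier → Carrier → Carrier → Carrier → Mat4 F
  Mψ₂ a b c d i j = vec F (row0 j) (row1 j) (row2 j) (row3 j) i
    where
    row0 row1 row2 row3 : Vec4 F
    row0 = vec F (a * a * a) (a * a * c) (a * c * c) (c * c * c)
    row1 = vec F (a * a * b) (a * a * d) (b * c * c) (c * c * d)
    row2 = vec F (a * (b * b)) (b * b * c) (a * d * d) (c * (d * d))
    row3 = vec F (b * b * b) (b * b * d) (b * d * d) (d * d * d)

  Mψ₂-cong : ∀ {a b c d a′ b′ c′ d′} → a ≈ a′ → b ≈ b′ → c ≈ c′ → d ≈ d′ →
             ∀ i j → Mψ₂ a b c d i j ≈ Mψ₂ a′ b′ c′ d′ i j
  Mψ₂-cong a b c d f0 f0                = *-cong (*-cong a a) a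
  Mψ₂-cong a b c d f0 (fs f0)           = *-cong (*-cong a a) c
  Mψ₂-cong a b c d f0 (fs (fs f0))      = *-cong (*-cong a c) c
  Mψ₂-cong a b c d f0 (fs (fs (fs f0))) = *-cong (*-cong c c) c
  Mψ₂-cong a b c d (fs f0) f0                = *-cong (*-cong a a) b
  Mψ₂-cong a b c d (fs f0) (fs f0)           = *-cong (*-cong a a) d
  Mψ₂-cong a b c d (fs f0) (fs (fs f0))      = *-cong (*-cong b c) c
  Mψ₂-cong a b c d (fs f0) (fs (fs (fs f0))) = *-cong (*-cong c c) d
  Mψ₂-cong a b c d (fs (fs f0)) f0                = *-cong a (*-cong b b)
  Mψ₂-cong a b c d (fs (fs f0)) (fs f0)           = *-cong (*-cong b b) c
  Mψ₂-cong a b c d (fs (fs f0)) (fs (fs f0))      = *-cong (*-cong a d) d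
  Mψ₂-cong a b c d (fs (fs f0)) (fs (fs (fs f0))) = *-cong c (*-cong d d)
  Mψ₂-cong a b c d (fs (fs (fs f0))) f0                = *-cong (*-cong b b) b
  Mψ₂-cong a b c d (fs (fs (fs f0))) (fs f0)           = *-cong (*-cong b b) d
  Mψ₂-cong a b c d (fs (fs (fs f0))) (fs (fs f0))      = *-cong (*-cong b d) d
  Mψ₂-cong a b c d (fs (fs (fs f0))) (fs (fs (fs f0))) = *-cong (*-cong d d) d

  ·Mψ₂-scalar : ∀ a x j → _·M_ F x (Mψ₂ a 0# 0# a) j ≈ a * a * a * x j
  ·Mψ₂-scalar a x f0 =
    solve 5 (λ a x₀ x₁ x₂ x₃ →
      x₀ :* (a :* a :* a) :+ x₁ :* (a :* a :* con 0) :+ x₂ :* (a :* (con 0 :* con 0))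
        :+ x₃ :* (con 0 :* con 0 :* con 0) := a :* a :* a :* x₀)
      refl a (x (# 0)) (x (# 1)) (x (# 2)) (x (# 3))
  ·Mψ₂-scalar a x (fs f0) =
    solve 5 (λ a x₀ x₁ x₂ x₃ →
      x₀ :* (a :* a :* con 0) :+ x₁ :* (a :* a :* a) :+ x₂ :* (con 0 :* con 0 :* con 0)
        :+ x₃ :* (con 0 :* con 0 :* a) := a :* a :* a :* x₁)
      refl a (x (# 0)) (x (# 1)) (x (# 2)) (x (# 3))
  ·Mψ₂-scalar a x (fs (fs f0)) =
    solve 5 (λ a x₀ x₁ x₂ x₃ →
      x₀ :* (a :* con 0 :* con 0) :+ x₁ :* (con 0 :* con 0 :* con 0) :+ x₂ :* (a :* a :* a)
        :+ x₃ :* (con 0 :* a :* a) := a :* a :* a :* x₂)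
      refl a (x (# 0)) (x (# 1)) (x (# 2)) (x (# 3))
  ·Mψ₂-scalar a x (fs (fs (fs f0))) =
    solve 5 (λ a x₀ x₁ x₂ x₃ →
      x₀ :* (con 0 :* con 0 :* con 0) :+ x₁ :* (con 0 :* con 0 :* a) :+ x₂ :* (con 0 :* (a :* a))
        :+ x₃ :* (a :* a :* a) := a :* a :* a :* x₃)
      refl a (x (# 0)) (x (# 1)) (x (# 2)) (x (# 3))

module Char2Properties {q : ℕ} (F : FiniteField q) (char2 : Char2 F) where
  open FiniteField F
  open FieldProperties F
  open MatrixProperties F
  open Solver commutativeSemiring
  open SetoidReasoning setoid

  x+x≈0 : ∀ x → x + x ≈ 0#
  x+x≈0 x = begin
    x + x              ≈⟨ +-cong (*-identityˡ x) (*-identityˡ x) ⟨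
    1# * x + 1# * x    ≈⟨ distribʳ x 1# 1# ⟨
    (1# + 1#) * x      ≈⟨ *-congʳ char2 ⟩
    0# * x             ≈⟨ zeroˡ x ⟩
    0#                 ∎

  x+y≈0⇒x≈y : ∀ {x y} → x + y ≈ 0# → x ≈ y
  x+y≈0⇒x≈y {x} {y} x+y≈0 = begin
    x              ≈⟨ +-identityʳ x ⟨
    x + 0#         ≈⟨ +-congˡ (x+x≈0 y) ⟨
    x + (y + y)    ≈⟨ +-assoc x y y ⟨
    x + y + y      ≈⟨ +-congʳ x+y≈0 ⟩
    0# + y         ≈⟨ +-identityˡ y ⟩
    y              ∎

  3#*x*y≈x*y : ∀ x y → 3# F * x * y ≈ x * y
  3#*x*y≈x*y x y = *-congʳ (trans (*-congʳ 3#≈1#) (*-identityˡ x))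
    where
    3#≈1# : 3# F ≈ 1#
    3#≈1# = trans (+-congʳ char2) (+-identityˡ 1#)

  x+2#*y*z*w≈x : ∀ x y z w → x + 2# F * y * z * w ≈ x
  x+2#*y*z*w≈x x y z w = trans (+-congˡ 2#*y*z*w≈0) (+-identityʳ x)
    where
    2#*y*z*w≈0 : 2# F * y * z * w ≈ 0#
    2#*y*z*w≈0 = trans (*-congʳ (trans (*-congʳ (trans (*-congʳ char2) (zeroˡ y)))
                                       (zeroˡ z)))
                       (zeroˡ w)

  x*x≈y*y⇒x≈y : ∀ {x y} → x * x ≈ y * y → x ≈ y
  x*x≈y*y⇒x≈y {x} {y} x*x≈y*y = x+y≈0⇒x≈y (x*x≈0⇒x≈0 (begin
    (x + y) * (x + y)              ≈⟨ expand x y ⟩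
    x * x + y * y + (x * y + x * y) ≈⟨ +-cong (+-congʳ x*x≈y*y) (x+x≈0 (x * y)) ⟩
    y * y + y * y + 0#             ≈⟨ +-identityʳ _ ⟩
    y * y + y * y                  ≈⟨ x+x≈0 (y * y) ⟩
    0#                             ∎))
    where
    expand : ∀ x y → (x + y) * (x + y) ≈ x * x + y * y + (x * y + x * y)
    expand = solve 2 (λ x y → (x :+ y) :* (x :+ y) := x :* x :+ y :* y :+ (x :* y :+ x :* y)) refl

  Mψ≈Mψ₂ : ∀ a b c d i j → Mψ F a b c d i j ≈ Mψ₂ a b c d i j
  Mψ≈Mψ₂ a b c d f0 f0                = refl
  Mψ≈Mψ₂ a b c d f0 (fs f0)           = refl
  Mψ≈Mψ₂ a b c d f0 (fs (fs f0))      = refl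
  Mψ≈Mψ₂ a b c d f0 (fs (fs (fs f0))) = refl
  Mψ≈Mψ₂ a b c d (fs f0) f0                = 3#*x*y≈x*y (a * a) b
  Mψ≈Mψ₂ a b c d (fs f0) (fs f0)           = x+2#*y*z*w≈x (a * a * d) a b c
  Mψ≈Mψ₂ a b c d (fs f0) (fs (fs f0))      = x+2#*y*z*w≈x (b * c * c) a c d
  Mψ≈Mψ₂ a b c d (fs f0) (fs (fs (fs f0))) = 3#*x*y≈x*y (c * c) d
  Mψ≈Mψ₂ a b c d (fs (fs f0)) f0                = 3#*x*y≈x*y a (b * b)
  Mψ≈Mψ₂ a b c d (fs (fs f0)) (fs f0)           = x+2#*y*z*w≈x (b * b * c) a b d
  Mψ≈Mψ₂ a b c d (fs (fs f0)) (fs (fs f0))      = x+2#*y*z*w≈x (a * d * d) b c d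
  Mψ≈Mψ₂ a b c d (fs (fs f0)) (fs (fs (fs f0))) = 3#*x*y≈x*y c (d * d)
  Mψ≈Mψ₂ a b c d (fs (fs (fs f0))) f0                = refl
  Mψ≈Mψ₂ a b c d (fs (fs (fs f0))) (fs f0)           = refl
  Mψ≈Mψ₂ a b c d (fs (fs (fs f0))) (fs (fs f0))      = refl
  Mψ≈Mψ₂ a b c d (fs (fs (fs f0))) (fs (fs (fs f0))) = refl

  ψmap≈·Mψ₂ : ∀ {a b c d b′ c′ d′} → b ≈ b′ → c ≈ c′ → d ≈ d′ →
              ∀ x j → ψmap F a b c d x j ≈ _·M_ F x (Mψ₂ a b′ c′ d′) j
  ψmap≈·Mψ₂ {a} {b} {c} {d} b≈b′ c≈c′ d≈d′ =
    ·M-congʳ (λ i j → trans (Mψ≈Mψ₂ a b c d i j) (Mψ₂-cong refl b≈b′ c≈c′ d≈d′ i j))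

module Stabiliser {q : ℕ} (F : FiniteField q) (char2 : Char2 F) (a b c d : FiniteField.Carrier F) where
  open FiniteField F
  open FieldProperties F
  open PointsAndLines F
  open MatrixProperties F
  open Char2Properties F char2
  open Solver commutativeSemiring
  open SetoidReasoning setoid

  ψ : Vec4 F → Vec4 F
  ψ = ψmap F a b c d

  fixes-R∞⇒c≈0 : a * d - b * c ≉ 0# → FixesPoint F ψ (R∞ F) → c ≈ 0#
  fixes-R∞⇒c≈0 det≉0 fixes with c ≟ 0#
  ... | yes c≈0 = c≈0
  ... | no c≉0 = ⊥-elim (det≉0 (begin
    a * d - b * c   ≈⟨ +-congʳ (*-cong a≈b (sym c≈d)) ⟩
    b * c - b * c   ≈⟨ -‿inverseʳ (b * c) ⟩
    0#              ∎))
    where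
    ψR∞≈ : ∀ j → ψ (R∞ F) j ≈ Mψ₂ a b c d (# 0) j + Mψ₂ a b c d (# 2) j
    ψR∞≈ j = trans (ψmap≈·Mψ₂ refl refl refl (R∞ F) j) (R∞·M (Mψ₂ a b c d) j)

    c*[x*x+y*y]≈0⇒x≈y : ∀ {x y} → c * (x * x + y * y) ≈ 0# → x ≈ y
    c*[x*x+y*y]≈0⇒x≈y ≈0 = x*x≈y*y⇒x≈y (x+y≈0⇒x≈y (*-cancelˡ-nonzero c≉0 (trans ≈0 (sym (zeroʳ c)))))

    a≈b : a ≈ b
    a≈b = c*[x*x+y*y]≈0⇒x≈y (begin
      c * (a * a + b * b)   ≈⟨ solve 3 (λ a b c → c :* (a :* a :+ b :* b) := a :* a :* c :+ b :* b :* c) refl a b c ⟩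
      a * a * c + b * b * c ≈⟨ ψR∞≈ (# 1) ⟨
      ψ (R∞ F) (# 1)        ≈⟨ proj₁ (samePoint-R∞ fixes) ⟩
      0#                    ∎)

    c≈d : c ≈ d
    c≈d = c*[x*x+y*y]≈0⇒x≈y (begin
      c * (c * c + d * d)      ≈⟨ solve 2 (λ c d → c :* (c :* c :+ d :* d) := c :* c :* c :+ c :* (d :* d)) refl c d ⟩
      c * c * c + c * (d * d)  ≈⟨ ψR∞≈ (# 3) ⟨
      ψ (R∞ F) (# 3)           ≈⟨ proj₂ (samePoint-R∞ fixes) ⟩
      0#                       ∎)

  c≈0⇒det≈a*d : c ≈ 0# → a * d - b * c ≈ a * d
  c≈0⇒det≈a*d c≈0 = trans (+-congˡ (trans (-‿cong (trans (*-congˡ c≈0) (zeroʳ b))) -0#≈0#))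
                          (+-identityʳ (a * d))
    where open RingProperties ring using (-0#≈0#)

  maps-ℓμ⇒b≈0×d≈a : ∀ {μ} → μ ≉ 0# → μ ≉ 1# → c ≈ 0# → d ≉ 0# →
    (∀ x → NonZeroV F x → OnLine F (Pμ F μ) (R∞ F) x → OnLine F (Pμ F μ) (R∞ F) (ψ x)) →
    b ≈ 0# × d ≈ a
  maps-ℓμ⇒b≈0×d≈a {μ} μ≉0 μ≉1 c≈0 d≉0 maps-line = b≈0 , sym (x*x≈y*y⇒x≈y a*a≈d*d)
    where
    y : Vec4 F
    y = ψ (Pμ F μ)

    y-onLine : y (# 0) ≈ y (# 2) × y (# 1) ≈ μ * y (# 3)
    y-onLine = onLine-Pμ-R∞ (maps-line (Pμ F μ) (# 3 , 1≉0) (onLine-left (Pμ F μ) (R∞ F)))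

    y≈ : ∀ j → y j ≈ μ * Mψ₂ a b 0# d (# 1) j + Mψ₂ a b 0# d (# 3) j
    y≈ j = trans (ψmap≈·Mψ₂ refl c≈0 refl (Pμ F μ) j) (Pμ·M μ (Mψ₂ a b 0# d) j)

    K : Carrier
    K = μ * (a * a) + b * b

    b*K≈b*[d*d] : b * K ≈ b * (d * d)
    b*K≈b*[d*d] = begin
      b * K                                 ≈⟨ solve 3 (λ a b μ → b :* (μ :* (a :* a) :+ b :* b)
                                                := μ :* (a :* a :* b) :+ b :* b :* b) refl a b μ ⟩
      μ * (a * a * b) + b * b * b           ≈⟨ y≈ (# 0) ⟨
      y (# 0)                               ≈⟨ proj₁ y-onLine ⟩
      y (# 2)                               ≈⟨ y≈ (# 2) ⟩
      μ * (b * 0# * 0#) + b * d * d         ≈⟨ solve 3 (λ b d μ → μ :* (b :* con 0 :* con 0) :+ b :* d :* d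
                                                := b :* (d :* d)) refl b d μ ⟩
      b * (d * d)                           ∎

    d*K≈d*[μ*[d*d]] : d * K ≈ d * (μ * (d * d))
    d*K≈d*[μ*[d*d]] = begin
      d * K                                 ≈⟨ solve 4 (λ a b d μ → d :* (μ :* (a :* a) :+ b :* b)
                                                := μ :* (a :* a :* d) :+ b :* b :* d) refl a b d μ ⟩
      μ * (a * a * d) + b * b * d           ≈⟨ y≈ (# 1) ⟨
      y (# 1)                               ≈⟨ proj₂ y-onLine ⟩
      μ * y (# 3)                           ≈⟨ *-congˡ (y≈ (# 3)) ⟩
      μ * (μ * (0# * 0# * d) + d * d * d)   ≈⟨ solve 2 (λ d μ → μ :* (μ :* (con 0 :* con 0 :* d) :+ d :* d :* d)
                                                := d :* (μ :* (d :* d))) refl d μ ⟩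
      d * (μ * (d * d))                     ∎

    K≈μ*[d*d] : K ≈ μ * (d * d)
    K≈μ*[d*d] = *-cancelˡ-nonzero d≉0 d*K≈d*[μ*[d*d]]

    b≈0 : b ≈ 0#
    b≈0 with b ≟ 0#
    ... | yes b≈0 = b≈0
    ... | no b≉0 = ⊥-elim (μ≉1 (*-cancelˡ-nonzero (*-nonzero d≉0 d≉0) (begin
      d * d * μ     ≈⟨ *-comm (d * d) μ ⟩
      μ * (d * d)   ≈⟨ K≈μ*[d*d] ⟨
      K             ≈⟨ *-cancelˡ-nonzero b≉0 b*K≈b*[d*d] ⟩
      d * d         ≈⟨ *-identityʳ (d * d) ⟨
      d * d * 1#    ∎)))

    a*a≈d*d : a * a ≈ d * d
    a*a≈d*d = *-cancelˡ-nonzero μ≉0 (begin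
      μ * (a * a)           ≈⟨ +-identityʳ _ ⟨
      μ * (a * a) + 0#      ≈⟨ +-congˡ (trans (*-congʳ b≈0) (zeroˡ b)) ⟨
      K                     ≈⟨ K≈μ*[d*d] ⟩
      μ * (d * d)           ∎)

lemma5p1 : (q : ℕ) → 8 ≤ q → (F : FiniteField q) → Char2 F →
    let open FiniteField F in
    (μ : Carrier) → μ ≉ 0# → μ ≉ 1# →
    (a b c d : Carrier) → a * d - b * c ≉ 0# →
    FixesLine F (ψmap F a b c d) (Pμ F μ) (R∞ F) →
    FixesPoint F (ψmap F a b c d) (R∞ F) →
    IsIdentity F (ψmap F a b c d)
lemma5p1 q _ F char2 μ μ≉0 μ≉1 a b c d det≉0 (maps-line , _) fixes-R∞ x _ =
  a * a * a , *-nonzero (*-nonzero a≉0 a≉0) a≉0 ,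
  λ j → trans (ψmap≈·Mψ₂ b≈0 c≈0 d≈a x j) (·Mψ₂-scalar a x j)
  where
  open FiniteField F
  open FieldProperties F
  open MatrixProperties F
  open Char2Properties F char2
  open Stabiliser F char2 a b c d

  c≈0 : c ≈ 0#
  c≈0 = fixes-R∞⇒c≈0 det≉0 fixes-R∞

  a*d≉0 : a * d ≉ 0#
  a*d≉0 a*d≈0 = det≉0 (trans (c≈0⇒det≈a*d c≈0) a*d≈0)

  a≉0 : a ≉ 0#
  a≉0 a≈0 = a*d≉0 (trans (*-congʳ a≈0) (zeroˡ d))

  d≉0 : d ≉ 0#
  d≉0 d≈0 = a*d≉0 (trans (*-congˡ d≈0) (zeroʳ a))

  b≈0×d≈a : b ≈ 0# × d ≈ a
  b≈0×d≈a = maps-ℓμ⇒b≈0×d≈a μ≉0 μ≉1 c≈0 d≉0 maps-line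

  b≈0 : b ≈ 0#
  b≈0 = proj₁ b≈0×d≈a

  d≈a : d ≈ a
  d≈a = proj₂ b≈0×d≈a
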